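{- Let $k\in\mathbb N$, $l_1,\dots,l_k\in\mathbb N_0$ with $l_1+\dots+l_k\ge 3$, $b\in\{0,1\}$, and \[\rho(x_1^1,\dots,x_{l_1}^1,\dots,x_1^k,\dots,x_{l_k}^k)=\Big(\sum_{i=1}^k\sum_{p=1}^{l_i}x_p^i=b\Big).\] Let $I=\{i\in E_k\mid l_i\ne0\}$ and $O=\{i\in E_k\mid l_i \text{ is odd}\}$. Then: (1) if $O=\emptyset$ and $b=0$, then $\langle\rho\rangle_{\mathrm{qpp}}=\langle\{x^i+y^i=u^j+v^j\mid i,j\in I\}\rangle_{\mathrm{qpp}}$; (2) if $O=\emptyset$ and $b=1$, then $\langle\rho\rangle_{\mathrm{qpp}}=\langle\{(x^i+y^i=u^j+v^j),\,(x^i+y^i=1)\mid i,j\in I\}\rangle_{\mathrm{qpp}}$; (3) if $O\ne\emptyset$, writing $O=\{p_1,\dots,p_m\}$, then $\langle\rho\rangle_{\mathrm{qpp}}=\langle\{x^{p_1}+\dots+x^{p_m}=b\}\cup\{x^i+y^i=u^j+v^j\mid i,j\in I\}\rangle_{\mathrm{qpp}}$.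
   Context: $E_k=\{1,\dots,k\}$; superscripts on variables denote sorts and arithmetic is mod 2. A $k$-sorted relation on $\{0,1\}$ is a subset of $\{0,1\}^n$ with each variable assigned a sort in $E_k$; a formula such as $x^i+y^i=u^j+v^j$ denotes the relation it defines on its variables with the indicated sorts. $\sigma_\bot$ is the empty $0$-ary relation, $\sigma^i_=$ equality on sort $i$. For a set $S$ of such relations, $\langle S\rangle_{\mathrm{qpp}}$ is the set of relations definable by formulas built from predicates in $S\cup\{\sigma_\bot,\sigma_=^1,\dots,\sigma_=^k\}$ using conjunction, existential and universal quantification only, each variable having one sort and substituted only into positions of that sort. -}

module Defs where

open import Data.Nat using (ℕ; zero; suc; _+_; _≤_)
open import Data.Bool using (Bool; true; false; _xor_; not)
open import Data.Fin using (Fin; zero; suc)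
open import Data.Vec.Functional using () renaming (_∷_ to _◃_)
open import Data.List using (List; []; length; lookup; replicate; concatMap; filter; map)
open import Data.List.Membership.Propositional using (_∈_)
open import Data.Fin.Base using () renaming (zero to f0)
open import Data.Sum using (_⊎_; inj₁; inj₂)
open import Data.Product using (Σ; _×_; _,_)
open import Data.Unit using (⊤)
open import Data.Empty using (⊥)
open import Relation.Binary.PropositionalEquality using (_≡_)
open import Relation.Nullary using (¬_; Dec; yes; no)
open import Data.Bool using () renaming (_≟_ to _≟B_)
open import Function.Bundles using (_⇔_)
open import Data.List.Base using (allFin) public

-- Sorted relations on {0,1}  (0 = false, 1 = true; + is xor)

record SRel (k : ℕ) : Set₁ where
  field
    arity : ℕ
    sort  : Fin arity → Fin k
    mem   : (Fin arity → Bool) → Set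
open SRel public

record RelSet (k : ℕ) : Set₁ where
  field
    Idx : Set
    rel : Idx → SRel k
open RelSet public

σ⊥ : ∀ {k} → SRel k
σ⊥ = record { arity = 0 ; sort = λ () ; mem = λ _ → ⊥ }

σ= : ∀ {k} → Fin k → SRel k
σ= i = record { arity = 2 ; sort = λ _ → i ; mem = λ t → t zero ≡ t (suc zero) }

Atom : ∀ {k} → RelSet k → Set
Atom {k} S = Idx S ⊎ (⊤ ⊎ Fin k)

atomRel : ∀ {k} (S : RelSet k) → Atom S → SRel k
atomRel S (inj₁ a)        = rel S a
atomRel S (inj₂ (inj₁ _)) = σ⊥
atomRel S (inj₂ (inj₂ i)) = σ= i

data Formula {k : ℕ} (S : RelSet k) : (m : ℕ) → (Fin m → Fin k) → Set where
  atom : ∀ {m Γ} (a : Atom S) (σ : Fin (arity (atomRel S a)) → Fin m) →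
         (∀ j → Γ (σ j) ≡ sort (atomRel S a) j) → Formula S m Γ
  and  : ∀ {m Γ} → Formula S m Γ → Formula S m Γ → Formula S m Γ
  ex   : ∀ {m Γ} (s : Fin k) → Formula S (suc m) (s ◃ Γ) → Formula S m Γ
  all  : ∀ {m Γ} (s : Fin k) → Formula S (suc m) (s ◃ Γ) → Formula S m Γ

⟦_⟧ : ∀ {k} {S : RelSet k} {m Γ} → Formula S m Γ → (Fin m → Bool) → Set
⟦ atom a σ _ ⟧ t = mem (atomRel _ a) (λ j → t (σ j))
⟦ and φ ψ ⟧ t = ⟦ φ ⟧ t × ⟦ ψ ⟧ t
⟦ ex s φ ⟧ t = Σ Bool λ b → ⟦ φ ⟧ (b ◃ t)
⟦ all s φ ⟧ t = (b : Bool) → ⟦ φ ⟧ (b ◃ t)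

_∈⟨_⟩ : ∀ {k} → SRel k → RelSet k → Set
R ∈⟨ S ⟩ = Σ (Formula S (arity R) (sort R)) λ φ → ∀ t → ⟦ φ ⟧ t ⇔ mem R t

_≐_ : ∀ {k} → RelSet k → RelSet k → Set₁
_≐_ {k} S T = ∀ (R : SRel k) → (R ∈⟨ S ⟩ → R ∈⟨ T ⟩) × (R ∈⟨ T ⟩ → R ∈⟨ S ⟩)

xorAll : ∀ {n} → (Fin n → Bool) → Bool
xorAll {zero}  t = false
xorAll {suc n} t = t zero xor xorAll (λ j → t (suc j))

isOdd : ℕ → Bool
isOdd zero    = false
isOdd (suc n) = not (isOdd n)

isNonzero : ℕ → Bool
isNonzero zero    = false
isNonzero (suc _) = true

sumRel : ∀ {k} → List (Fin k) → Bool → SRel k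
sumRel ss b = record { arity = length ss ; sort = lookup ss ; mem = λ t → xorAll t ≡ b }

ρSorts : ∀ {k} → (Fin k → ℕ) → List (Fin k)
ρSorts {k} l = concatMap (λ i → replicate (l i) i) (allFin k)

ρ : ∀ {k} → (Fin k → ℕ) → Bool → SRel k
ρ l b = sumRel (ρSorts l) b

Iset : ∀ {k} → (Fin k → ℕ) → List (Fin k)
Iset {k} l = filter (λ i → isNonzero (l i) ≟B true) (allFin k)

Oset : ∀ {k} → (Fin k → ℕ) → List (Fin k)
Oset {k} l = filter (λ i → isOdd (l i) ≟B true) (allFin k)

eqSum : ∀ {k} → Fin k → Fin k → SRel k
eqSum i j = record
  { arity = 4
  ; sort  = λ { zero → i ; (suc zero) → i ; (suc (suc _)) → j }
  ; mem   = λ t → (t zero xor t (suc zero)) ≡ (t (suc (suc zero)) xor t (suc (suc (suc zero)))) }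

sumOne : ∀ {k} → Fin k → SRel k
sumOne i = record { arity = 2 ; sort = λ _ → i ; mem = λ t → (t zero xor t (suc zero)) ≡ true }

singleton : ∀ {k} → SRel k → RelSet k
singleton R = record { Idx = ⊤ ; rel = λ _ → R }

IPair : ∀ {k} → (Fin k → ℕ) → Set
IPair {k} l = Σ (Fin k) (λ i → i ∈ Iset l) × Σ (Fin k) (λ j → j ∈ Iset l)

S1 : ∀ {k} → (Fin k → ℕ) → RelSet k
S1 l = record { Idx = IPair l ; rel = λ { ((i , _) , (j , _)) → eqSum i j } }

S2 : ∀ {k} → (Fin k → ℕ) → RelSet k
S2 {k} l = record
  { Idx = IPair l ⊎ Σ (Fin k) (λ i → i ∈ Iset l)
  ; rel = λ { (inj₁ ((i , _) , (j , _))) → eqSum i j ; (inj₂ (i , _)) → sumOne i } }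

S3 : ∀ {k} → (Fin k → ℕ) → Bool → RelSet k
S3 l b = record
  { Idx = ⊤ ⊎ IPair l
  ; rel = λ { (inj₁ _) → sumRel (Oset l) b ; (inj₂ ((i , _) , (j , _))) → eqSum i j } }

{-# OPTIONS --safe #-}

-- Every relation involved is a parity condition  Σ x = β.  Given the pair equations
-- x + y = u + v on the sorts of I, the equation  Σ_q x_q = Σ_q y_q  is definable for any two
-- families of variables in which every sort occurs equally often mod 2: pair each variable
-- with a shared fresh variable W_s of its sort, chain the pair equations through auxiliary
-- variables, and the W's cancel.  Hence  Σ x = β  is definable from any relation  Σ y = β
-- with the same sort parities.  The sorts of ρ occur l_i times, so ρ and
-- x^{p_1} + … + x^{p_m} = b  define each other; when all l_i are even, ρ with b = 1 and
-- x^i + y^i = 1  define each other, and ρ with b = 0 needs only the pair equations.  These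
-- come from ρ itself: two instances of ρ that differ only at two positions force
-- x + y = u + v, a third position absorbing the sum of the remaining arguments.

module Submission where

open import Defs
open import Data.Nat using (ℕ; zero; suc; _+_; _≤_; s≤s; z≤n)
open import Data.Nat.Properties using (≤-trans)
open import Data.Nat.ListAction using (sum)
open import Data.Bool using (Bool; true; false; not; _xor_; _∧_) renaming (_≟_ to _≟B_)
open import Data.Bool.Properties using (xor-assoc; xor-comm; xor-identityʳ; xor-same)
open import Data.Bool.Solver using (module xor-∧-Solver)
open import Data.Fin using (Fin; zero; suc; lift; fromℕ<; _↑ˡ_; _↑ʳ_)
open import Data.Vec.Functional using (updateAt) renaming (_∷_ to _◃_)
open import Data.Vec.Functional.Properties using (updateAt-minimal)
open import Data.List
  using (List; []; _∷_; _++_; foldr; length; lookup; map; replicate; filter; tabulate; concatMap)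
open import Data.List.Properties using (length-++; length-replicate)
open import Data.List.Membership.Propositional using (_∈_)
open import Data.List.Membership.Propositional.Properties
  using (∈-filter⁺; ∈-filter⁻; ∈-allFin; ∈-lookup; ∈-concatMap⁺; ∈-concatMap⁻)
open import Data.List.Relation.Unary.Any using (here; there; index; satisfied)
import Data.List.Relation.Unary.Any as Any
open import Data.List.Relation.Unary.Any.Properties using (lookup-index)
open import Data.Sum using (inj₁; inj₂)
open import Data.Unit using (tt)
open import Data.Product using (Σ; ∃-syntax; _×_; _,_; proj₁; proj₂; map₂)
open import Data.Product.Function.NonDependent.Propositional using (_×-⇔_)
open import Function using (_∘_; id; const; _⇔_; mk⇔; Equivalence)
open import Function.Properties.Equivalence using () renaming (sym to ⇔-sym; trans to ⇔-trans)
open import Relation.Binary.PropositionalEquality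
  using (_≡_; _≢_; ≢-sym; refl; sym; trans; cong; cong₂; subst; _≗_; module ≡-Reasoning)
open import Relation.Nullary using (contradiction)

open xor-∧-Solver using (solve; _:+_; _:=_)
open Equivalence using (to; from)

private
  variable
    A : Set
    k m n d e : ℕ

-- Definability

-- Relations are arbitrary predicates on tuples; substituting into formulas needs them to
-- respect pointwise equality.
Extensional : SRel k → Set
Extensional R = ∀ {t u} → t ≗ u → mem R t → mem R u

Definable : RelSet k → (Fin m → Fin k) → ((Fin m → Bool) → Set) → Set
Definable {m = m} S Γ P = Σ (Formula S m Γ) λ φ → ∀ t → ⟦ φ ⟧ t ⇔ P t

∃-⇔ : {P Q : Bool → Set} → (∀ b → P b ⇔ Q b) → (∃[ b ] P b) ⇔ (∃[ b ] Q b)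
∃-⇔ P⇔Q = mk⇔ (map₂ (to (P⇔Q _))) (map₂ (from (P⇔Q _)))

∀-⇔ : {P Q : Bool → Set} → (∀ b → P b ⇔ Q b) → (∀ b → P b) ⇔ (∀ b → Q b)
∀-⇔ P⇔Q = mk⇔ (λ f b → to (P⇔Q b) (f b)) (λ f b → from (P⇔Q b) (f b))

◃-cong : (x : A) {f g : Fin m → A} → f ≗ g → x ◃ f ≗ x ◃ g
◃-cong x f≗g zero    = refl
◃-cong x f≗g (suc j) = f≗g j

◃-lift : (x : A) {f : Fin m → A} {g : Fin n → A} {σ : Fin n → Fin m} →
         f ∘ σ ≗ g → (x ◃ f) ∘ lift 1 σ ≗ x ◃ g
◃-lift x f∘σ≗g zero    = refl
◃-lift x f∘σ≗g (suc j) = f∘σ≗g j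

-- Unlike Data.Vec.Functional._++_, this unfolds to  w zero ◃ …  definitionally, which is
-- the shape of the context under a block of ex-binders.
infixr 5 _⧺_
_⧺_ : (Fin d → A) → (Fin m → A) → Fin (d + m) → A
_⧺_ {d = zero}  w t = t
_⧺_ {d = suc d} w t = w zero ◃ (w ∘ suc) ⧺ t

⧺-↑ˡ : ∀ (w : Fin d → A) (t : Fin m → A) i → (w ⧺ t) (i ↑ˡ m) ≡ w i
⧺-↑ˡ w t zero    = refl
⧺-↑ˡ w t (suc i) = ⧺-↑ˡ (w ∘ suc) t i

⧺-↑ʳ : ∀ (w : Fin d → A) (t : Fin m → A) v → (w ⧺ t) (d ↑ʳ v) ≡ t v
⧺-↑ʳ {d = zero}  w t v = refl
⧺-↑ʳ {d = suc d} w t v = ⧺-↑ʳ (w ∘ suc) t v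

module _ {k : ℕ} {S : RelSet k} where

  definable-⇔ : {Γ : Fin m → Fin k} {P Q : (Fin m → Bool) → Set} →
                Definable S Γ P → (∀ t → P t ⇔ Q t) → Definable S Γ Q
  definable-⇔ (φ , φ⇔P) P⇔Q = φ , λ t → ⇔-trans (φ⇔P t) (P⇔Q t)

  definable-atom : {Γ : Fin m → Fin k} (a : Atom S) (σ : Fin (arity (atomRel S a)) → Fin m) →
                   (∀ j → Γ (σ j) ≡ sort (atomRel S a) j) →
                   Definable S Γ (λ t → mem (atomRel S a) (t ∘ σ))
  definable-atom a σ σ-sorts = atom a σ σ-sorts , λ t → mk⇔ id id

  definable-× : {Γ : Fin m → Fin k} {P Q : (Fin m → Bool) → Set} →
                Definable S Γ P → Definable S Γ Q → Definable S Γ (λ t → P t × Q t)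
  definable-× (φ , φ⇔P) (ψ , ψ⇔Q) = and φ ψ , λ t → φ⇔P t ×-⇔ ψ⇔Q t

  definable-∃ : {Γ : Fin m → Fin k} (s : Fin k) {P : (Fin (suc m) → Bool) → Set} →
                Definable S (s ◃ Γ) P → Definable S Γ (λ t → ∃[ b ] P (b ◃ t))
  definable-∃ s (φ , φ⇔P) = ex s φ , λ t → ∃-⇔ (λ b → φ⇔P (b ◃ t))

  definable-∀ : {Γ : Fin m → Fin k} (s : Fin k) {P : (Fin (suc m) → Bool) → Set} →
                Definable S (s ◃ Γ) P → Definable S Γ (λ t → ∀ b → P (b ◃ t))
  definable-∀ s (φ , φ⇔P) = all s φ , λ t → ∀-⇔ (λ b → φ⇔P (b ◃ t))

  definable-∃ⁿ : {Γ : Fin m → Fin k} (Δ : Fin d → Fin k) {P : (Fin (d + m) → Bool) → Set} →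
                 Definable S (Δ ⧺ Γ) P → Definable S Γ (λ t → ∃[ w ] P (w ⧺ t))
  definable-∃ⁿ {d = zero}  Δ φ = definable-⇔ φ λ t →
    mk⇔ (λ holds → (λ ()) , holds) (λ (_ , holds) → holds)
  definable-∃ⁿ {d = suc d} Δ φ = definable-⇔ (definable-∃ⁿ (Δ ∘ suc) (definable-∃ (Δ zero) φ)) λ t →
    mk⇔ (λ (w , b , holds) → b ◃ w , holds) (λ (w , holds) → w ∘ suc , w zero , holds)

  rel∈⟨⟩ : ∀ a → rel S a ∈⟨ S ⟩
  rel∈⟨⟩ a = definable-atom (inj₁ a) id (λ _ → refl)

module _ {k : ℕ} {S : RelSet k} (S-ext : ∀ a → Extensional (rel S a)) where

  atom-extensional : ∀ a → Extensional (atomRel S a)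
  atom-extensional (inj₁ a)        = S-ext a
  atom-extensional (inj₂ (inj₁ _)) _ ()
  atom-extensional (inj₂ (inj₂ _)) t≗u t₀≡t₁ =
    trans (sym (t≗u zero)) (trans t₀≡t₁ (t≗u (suc zero)))

  ⟦⟧-cong : {Γ : Fin m → Fin k} (φ : Formula S m Γ) {t u : Fin m → Bool} →
            t ≗ u → ⟦ φ ⟧ t → ⟦ φ ⟧ u
  ⟦⟧-cong (atom a σ _) t≗u = atom-extensional a (t≗u ∘ σ)
  ⟦⟧-cong (and φ ψ)    t≗u = λ (φ-holds , ψ-holds) →
    ⟦⟧-cong φ t≗u φ-holds , ⟦⟧-cong ψ t≗u ψ-holds
  ⟦⟧-cong (ex s φ)     t≗u = map₂ (⟦⟧-cong φ (◃-cong _ t≗u))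
  ⟦⟧-cong (all s φ)    t≗u = λ holds b → ⟦⟧-cong φ (◃-cong b t≗u) (holds b)

  ⟦⟧-cong-⇔ : {Γ : Fin m → Fin k} (φ : Formula S m Γ) {t u : Fin m → Bool} →
              t ≗ u → ⟦ φ ⟧ t ⇔ ⟦ φ ⟧ u
  ⟦⟧-cong-⇔ φ t≗u = mk⇔ (⟦⟧-cong φ t≗u) (⟦⟧-cong φ (sym ∘ t≗u))

  rename : {Γ : Fin m → Fin k} {Δ : Fin n → Fin k} (σ : Fin n → Fin m) → (∀ j → Γ (σ j) ≡ Δ j) →
           (φ : Formula S n Δ) → Definable S Γ (λ t → ⟦ φ ⟧ (t ∘ σ))
  rename σ σ-sorts (atom a τ τ-sorts) =
    definable-atom a (σ ∘ τ) (λ j → trans (σ-sorts (τ j)) (τ-sorts j))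
  rename σ σ-sorts (and φ ψ) = definable-× (rename σ σ-sorts φ) (rename σ σ-sorts ψ)
  rename σ σ-sorts (ex s φ) = definable-⇔ (definable-∃ s (rename (lift 1 σ) (◃-lift s σ-sorts) φ))
    λ t → ∃-⇔ λ b → ⟦⟧-cong-⇔ φ (◃-lift b (λ _ → refl))
  rename σ σ-sorts (all s φ) = definable-⇔ (definable-∀ s (rename (lift 1 σ) (◃-lift s σ-sorts) φ))
    λ t → ∀-⇔ λ b → ⟦⟧-cong-⇔ φ (◃-lift b (λ _ → refl))

  definable-rename : {Γ : Fin m → Fin k} {Δ : Fin n → Fin k} {P : (Fin n → Bool) → Set} →
                     Definable S Δ P → (σ : Fin n → Fin m) → (∀ j → Γ (σ j) ≡ Δ j) →
                     Definable S Γ (λ t → P (t ∘ σ))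
  definable-rename (φ , φ⇔P) σ σ-sorts = definable-⇔ (rename σ σ-sorts φ) (λ t → φ⇔P (t ∘ σ))

module _ {k : ℕ} {S T : RelSet k} (T-ext : ∀ a → Extensional (rel T a))
         (S⊆⟨T⟩ : ∀ a → rel S a ∈⟨ T ⟩) where

  translate : {Γ : Fin m → Fin k} (φ : Formula S m Γ) → Definable T Γ ⟦ φ ⟧
  translate (atom (inj₁ a) σ σ-sorts)         = definable-rename T-ext (S⊆⟨T⟩ a) σ σ-sorts
  translate (atom (inj₂ (inj₁ tt)) σ σ-sorts) = definable-atom (inj₂ (inj₁ tt)) σ σ-sorts
  translate (atom (inj₂ (inj₂ i)) σ σ-sorts)  = definable-atom (inj₂ (inj₂ i)) σ σ-sorts
  translate (and φ ψ) = definable-× (translate φ) (translate ψ)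
  translate (ex s φ)  = definable-∃ s (translate φ)
  translate (all s φ) = definable-∀ s (translate φ)

  ∈⟨⟩-trans : ∀ {R} → R ∈⟨ S ⟩ → R ∈⟨ T ⟩
  ∈⟨⟩-trans (φ , φ⇔R) = definable-⇔ (translate φ) φ⇔R

≐-intro : {S T : RelSet k} → (∀ a → Extensional (rel S a)) → (∀ a → Extensional (rel T a)) →
          (∀ a → rel S a ∈⟨ T ⟩) → (∀ a → rel T a ∈⟨ S ⟩) → S ≐ T
≐-intro S-ext T-ext S⊆⟨T⟩ T⊆⟨S⟩ R = ∈⟨⟩-trans T-ext S⊆⟨T⟩ , ∈⟨⟩-trans S-ext T⊆⟨S⟩

-- Parities

xor-cancelʳ : ∀ {a b} c → a xor c ≡ b xor c → a ≡ b
xor-cancelʳ {a} {b} c eq = begin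
  a               ≡⟨ solve 2 (λ a c → a := (a :+ c) :+ c) refl a c ⟩
  (a xor c) xor c ≡⟨ cong (_xor c) eq ⟩
  (b xor c) xor c ≡⟨ solve 2 (λ b c → (b :+ c) :+ c := b) refl b c ⟩
  b               ∎
  where open ≡-Reasoning

xor-cancelˡ : ∀ a {b c} → a xor b ≡ a xor c → b ≡ c
xor-cancelˡ a {b} {c} eq = xor-cancelʳ a (trans (xor-comm b a) (trans eq (xor-comm a c)))

xor-transpose : ∀ {x y u v} → x xor y ≡ u xor v → x xor u ≡ y xor v
xor-transpose {x} {y} {u} {v} eq = begin
  x xor u               ≡⟨ solve 3 (λ x y u → x :+ u := (x :+ y) :+ (y :+ u)) refl x y u ⟩
  (x xor y) xor y xor u ≡⟨ cong (_xor y xor u) eq ⟩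
  (u xor v) xor y xor u ≡⟨ solve 3 (λ y u v → (u :+ v) :+ (y :+ u) := y :+ v) refl y u v ⟩
  y xor v               ∎
  where open ≡-Reasoning

xorAll-cong : {f g : Fin n → Bool} → f ≗ g → xorAll f ≡ xorAll g
xorAll-cong {n = zero}  f≗g = refl
xorAll-cong {n = suc n} f≗g = cong₂ _xor_ (f≗g zero) (xorAll-cong (f≗g ∘ suc))

xorAll-false : ∀ n → xorAll {n} (const false) ≡ false
xorAll-false zero    = refl
xorAll-false (suc n) = xorAll-false n

xorAll-xor : (f g : Fin n → Bool) → xorAll (λ j → f j xor g j) ≡ xorAll f xor xorAll g
xorAll-xor {n = zero}  f g = refl
xorAll-xor {n = suc n} f g = trans (cong ((f zero xor g zero) xor_) (xorAll-xor (f ∘ suc) (g ∘ suc)))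
  (solve 4 (λ a b x y → (a :+ b) :+ (x :+ y) := (a :+ x) :+ (b :+ y)) refl (f zero) (g zero) _ _)

xorAll-point : ∀ (j : Fin n) β → xorAll (updateAt (const false) j (const β)) ≡ β
xorAll-point {n = suc n} zero    β = trans (cong (β xor_) (xorAll-false n)) (xor-identityʳ β)
xorAll-point             (suc j) β = xorAll-point j β

xorAll-updateAt : ∀ (t : A → Bool) (σ : Fin n → A) p v →
                  xorAll (t ∘ updateAt σ p (const v)) ≡ xorAll (t ∘ σ) xor (t (σ p) xor t v)
xorAll-updateAt t σ zero v =
  solve 3 (λ a x c → c :+ x := (a :+ x) :+ (a :+ c)) refl (t (σ zero)) (xorAll (t ∘ σ ∘ suc)) (t v)
xorAll-updateAt t σ (suc p) v = trans (cong (t (σ zero) xor_) (xorAll-updateAt t (σ ∘ suc) p v))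
  (sym (xor-assoc (t (σ zero)) _ _))

xorAll-updateAt₃ : (t : A → Bool) (σ : Fin n → A) {p q r : Fin n} →
  p ≢ q → p ≢ r → q ≢ r → ∀ a c z →
  xorAll (t ∘ updateAt (updateAt (updateAt σ r (const z)) q (const c)) p (const a))
  ≡ (xorAll (t ∘ σ) xor t (σ r) xor t (σ q) xor t (σ p)) xor (t z xor t c xor t a)
xorAll-updateAt₃ t σ {p} {q} {r} p≢q p≢r q≢r a c z = begin
  xorAll (t ∘ σ‴)
    ≡⟨ xorAll-updateAt t σ″ p a ⟩
  xorAll (t ∘ σ″) xor (t (σ″ p) xor t a)
    ≡⟨ cong (λ e → xorAll (t ∘ σ″) xor (t e xor t a)) σ″p ⟩
  xorAll (t ∘ σ″) xor (t (σ p) xor t a)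
    ≡⟨ cong (_xor (t (σ p) xor t a)) (xorAll-updateAt t σ′ q c) ⟩
  (xorAll (t ∘ σ′) xor (t (σ′ q) xor t c)) xor (t (σ p) xor t a)
    ≡⟨ cong (λ e → (xorAll (t ∘ σ′) xor (t e xor t c)) xor (t (σ p) xor t a)) σ′q ⟩
  (xorAll (t ∘ σ′) xor (t (σ q) xor t c)) xor (t (σ p) xor t a)
    ≡⟨ cong (λ e → (e xor (t (σ q) xor t c)) xor (t (σ p) xor t a)) (xorAll-updateAt t σ r z) ⟩
  ((xorAll (t ∘ σ) xor (t (σ r) xor t z)) xor (t (σ q) xor t c)) xor (t (σ p) xor t a)
    ≡⟨ solve 7 (λ S R Q P z c a → ((S :+ (R :+ z)) :+ (Q :+ c)) :+ (P :+ a)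
                                 := (S :+ (R :+ (Q :+ P))) :+ (z :+ (c :+ a)))
         refl (xorAll (t ∘ σ)) (t (σ r)) (t (σ q)) (t (σ p)) (t z) (t c) (t a) ⟩
  (xorAll (t ∘ σ) xor t (σ r) xor t (σ q) xor t (σ p)) xor (t z xor t c xor t a) ∎
  where
  open ≡-Reasoning
  σ′ = updateAt σ r (const z)
  σ″ = updateAt σ′ q (const c)
  σ‴ = updateAt σ″ p (const a)
  σ′q : σ′ q ≡ σ q
  σ′q = updateAt-minimal q r σ q≢r
  σ″p : σ″ p ≡ σ p
  σ″p = trans (updateAt-minimal p q σ′ p≢q) (updateAt-minimal p r σ p≢r)

∘-updateAt : ∀ {B : Set} (f : A → B) {g : Fin n → A} {h : Fin n → B} p {a : A} →
             (∀ j → f (g j) ≡ h j) → f a ≡ h p → ∀ j → f (updateAt g p (const a) j) ≡ h j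
∘-updateAt f zero    f∘g≗h fa≡hp zero    = fa≡hp
∘-updateAt f zero    f∘g≗h fa≡hp (suc j) = f∘g≗h (suc j)
∘-updateAt f (suc p) f∘g≗h fa≡hp zero    = f∘g≗h zero
∘-updateAt f (suc p) f∘g≗h fa≡hp (suc j) = ∘-updateAt f p (f∘g≗h ∘ suc) fa≡hp j

parity : (A → Bool) → List A → Bool
parity W = foldr (λ x s → W x xor s) false

xorAll-lookup : ∀ (W : A → Bool) xs → xorAll (W ∘ lookup xs) ≡ parity W xs
xorAll-lookup W []       = refl
xorAll-lookup W (x ∷ xs) = cong (W x xor_) (xorAll-lookup W xs)

parity-++ : ∀ (W : A → Bool) xs ys → parity W (xs ++ ys) ≡ parity W xs xor parity W ys
parity-++ W []       ys = refl
parity-++ W (x ∷ xs) ys = trans (cong (W x xor_) (parity-++ W xs ys)) (sym (xor-assoc (W x) _ _))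

parity-replicate : ∀ (W : A → Bool) n x → parity W (replicate n x) ≡ isOdd n ∧ W x
parity-replicate W zero    x = refl
parity-replicate W (suc n) x = trans (cong (W x xor_) (parity-replicate W n x)) (flip-parity (isOdd n) (W x))
  where
  flip-parity : ∀ a w → w xor (a ∧ w) ≡ not a ∧ w
  flip-parity false w = xor-identityʳ w
  flip-parity true  w = xor-same w

parity-tabulate : (W : A → Bool) (f : Fin n → A) → parity W (tabulate f) ≡ xorAll (W ∘ f)
parity-tabulate {n = zero}  W f = refl
parity-tabulate {n = suc n} W f = cong (W (f zero) xor_) (parity-tabulate W (f ∘ suc))

parity-filter : ∀ (W c : A → Bool) xs →
                parity W (filter (λ x → c x ≟B true) xs) ≡ parity (λ x → c x ∧ W x) xs
parity-filter W c []       = refl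
parity-filter W c (x ∷ xs) with c x
... | true  = cong (W x xor_) (parity-filter W c xs)
... | false = parity-filter W c xs

parity-concatMap-replicate : ∀ (W : A → Bool) (l : A → ℕ) xs →
  parity W (concatMap (λ x → replicate (l x) x) xs) ≡ parity (λ x → isOdd (l x) ∧ W x) xs
parity-concatMap-replicate W l []       = refl
parity-concatMap-replicate W l (x ∷ xs) = begin
  parity W (replicate (l x) x ++ concatMap (λ x → replicate (l x) x) xs)
    ≡⟨ parity-++ W (replicate (l x) x) _ ⟩
  parity W (replicate (l x) x) xor parity W (concatMap (λ x → replicate (l x) x) xs)
    ≡⟨ cong₂ _xor_ (parity-replicate W (l x) x) (parity-concatMap-replicate W l xs) ⟩
  (isOdd (l x) ∧ W x) xor parity (λ x → isOdd (l x) ∧ W x) xs ∎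
  where open ≡-Reasoning

weightedParity : (Fin k → ℕ) → (Fin k → Bool) → Bool
weightedParity l W = xorAll (λ i → isOdd (l i) ∧ W i)

SameSortParity : (Fin d → Fin k) → (Fin e → Fin k) → Set
SameSortParity Δ Δ′ = ∀ W → xorAll (W ∘ Δ) ≡ xorAll (W ∘ Δ′)

IsParityRel : SRel k → Bool → Set
IsParityRel R β = ∀ Y → mem R Y ⇔ (xorAll Y ≡ β)

-- The sorts of ρ

∈-replicate⁺ : (x : A) → isNonzero n ≡ true → x ∈ replicate n x
∈-replicate⁺ {n = suc n} x _ = here refl

∈-replicate⁻ : ∀ {x y : A} n → x ∈ replicate n y → x ≡ y × isNonzero n ≡ true
∈-replicate⁻ (suc n) (here x≡y) = x≡y , refl
∈-replicate⁻ (suc n) (there x∈) = proj₁ (∈-replicate⁻ n x∈) , refl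

length-concatMap-replicate : ∀ (l : A → ℕ) xs →
                             length (concatMap (λ x → replicate (l x) x) xs) ≡ sum (map l xs)
length-concatMap-replicate l []       = refl
length-concatMap-replicate l (x ∷ xs) = trans (length-++ (replicate (l x) x))
  (cong₂ _+_ (length-replicate (l x)) (length-concatMap-replicate l xs))

isOdd⇒isNonzero : ∀ n → isOdd n ≡ true → isNonzero n ≡ true
isOdd⇒isNonzero (suc n) _ = refl

avoid-two : 3 ≤ n → (a c : Fin n) → ∃[ r ] r ≢ a × r ≢ c
avoid-two (s≤s (s≤s (s≤s _))) zero          zero          = suc zero , (λ ()) , (λ ())
avoid-two (s≤s (s≤s (s≤s _))) zero          (suc zero)    = suc (suc zero) , (λ ()) , (λ ())
avoid-two (s≤s (s≤s (s≤s _))) zero          (suc (suc _)) = suc zero , (λ ()) , (λ ())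
avoid-two (s≤s (s≤s (s≤s _))) (suc zero)    zero          = suc (suc zero) , (λ ()) , (λ ())
avoid-two (s≤s (s≤s (s≤s _))) (suc (suc _)) zero          = suc zero , (λ ()) , (λ ())
avoid-two (s≤s (s≤s (s≤s _))) (suc _)       (suc _)       = zero , (λ ()) , (λ ())

nonempty-index : (xs : List A) → xs ≢ [] → Fin (length xs)
nonempty-index []      xs≢[] = contradiction refl xs≢[]
nonempty-index (_ ∷ _) _     = zero

module _ {k : ℕ} (l : Fin k → ℕ) where

  ∈Iset⁺ : ∀ {i} → isNonzero (l i) ≡ true → i ∈ Iset l
  ∈Iset⁺ = ∈-filter⁺ (λ i → isNonzero (l i) ≟B true) (∈-allFin _)

  ∈Iset⁻ : ∀ {i} → i ∈ Iset l → isNonzero (l i) ≡ true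
  ∈Iset⁻ = proj₂ ∘ ∈-filter⁻ (λ i → isNonzero (l i) ≟B true) {xs = allFin k}

  ∈Oset⁻ : ∀ {i} → i ∈ Oset l → isOdd (l i) ≡ true
  ∈Oset⁻ = proj₂ ∘ ∈-filter⁻ (λ i → isOdd (l i) ≟B true) {xs = allFin k}

  Oset⊆Iset : ∀ {i} → i ∈ Oset l → i ∈ Iset l
  Oset⊆Iset i∈O = ∈Iset⁺ (isOdd⇒isNonzero _ (∈Oset⁻ i∈O))

  Oset≡[]⇒even : Oset l ≡ [] → ∀ i → isOdd (l i) ≡ false
  Oset≡[]⇒even O≡[] i with isOdd (l i) in odd
  ... | false = refl
  ... | true  = contradiction (subst (i ∈_) O≡[] (∈-filter⁺ (λ i → isOdd (l i) ≟B true) (∈-allFin i) odd))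
                  λ ()

  sort∈Iset : ∀ pos → lookup (ρSorts l) pos ∈ Iset l
  sort∈Iset pos
    with _ , i∈rep ← satisfied (∈-concatMap⁻ (λ j → replicate (l j) j) {xs = allFin k} (∈-lookup pos))
    with refl , nonzero ← ∈-replicate⁻ _ i∈rep = ∈Iset⁺ nonzero

  position : ∀ {i} → i ∈ Iset l → ∃[ pos ] lookup (ρSorts l) pos ≡ i
  position {i} i∈I = index i∈ρ , sym (lookup-index i∈ρ)
    where
    i∈ρ : i ∈ ρSorts l
    i∈ρ = ∈-concatMap⁺ (λ j → replicate (l j) j)
            (Any.map (λ { refl → ∈-replicate⁺ i (∈Iset⁻ i∈I) }) (∈-allFin i))

  xorAll-ρSorts : ∀ W → xorAll (W ∘ lookup (ρSorts l)) ≡ weightedParity l W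
  xorAll-ρSorts W = begin
    xorAll (W ∘ lookup (ρSorts l))                 ≡⟨ xorAll-lookup W (ρSorts l) ⟩
    parity W (ρSorts l)                            ≡⟨ parity-concatMap-replicate W l (allFin k) ⟩
    parity (λ i → isOdd (l i) ∧ W i) (tabulate id) ≡⟨ parity-tabulate (λ i → isOdd (l i) ∧ W i) id ⟩
    weightedParity l W                             ∎
    where open ≡-Reasoning

  xorAll-Oset : ∀ W → xorAll (W ∘ lookup (Oset l)) ≡ weightedParity l W
  xorAll-Oset W = begin
    xorAll (W ∘ lookup (Oset l))                   ≡⟨ xorAll-lookup W (Oset l) ⟩
    parity W (Oset l)                              ≡⟨ parity-filter W (isOdd ∘ l) (allFin k) ⟩
    parity (λ i → isOdd (l i) ∧ W i) (tabulate id) ≡⟨ parity-tabulate (λ i → isOdd (l i) ∧ W i) id ⟩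
    weightedParity l W                             ∎
    where open ≡-Reasoning

  xorAll-ρSorts-even : Oset l ≡ [] → ∀ W → xorAll (W ∘ lookup (ρSorts l)) ≡ false
  xorAll-ρSorts-even O≡[] W = trans (xorAll-ρSorts W)
    (trans (xorAll-cong (λ i → cong (_∧ W i) (Oset≡[]⇒even O≡[] i))) (xorAll-false k))

-- Pair equations

sumRel-extensional : ∀ (ss : List (Fin k)) β → Extensional (sumRel ss β)
sumRel-extensional ss β t≗u sum≡β = trans (sym (xorAll-cong t≗u)) sum≡β

eqSum-extensional : (i j : Fin k) → Extensional (eqSum i j)
eqSum-extensional i j t≗u eq = trans (sym (cong₂ _xor_ (t≗u zero) (t≗u (suc zero))))
  (trans eq (cong₂ _xor_ (t≗u (suc (suc zero))) (t≗u (suc (suc (suc zero))))))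

sumOne-extensional : (i : Fin k) → Extensional (sumOne i)
sumOne-extensional i t≗u sum≡1 = trans (sym (cong₂ _xor_ (t≗u zero) (t≗u (suc zero)))) sum≡1

sumOne-parity : (i : Fin k) → IsParityRel (sumOne i) true
sumOne-parity i Y = mk⇔ (trans drop-false) (trans (sym drop-false))
  where drop-false = cong (Y zero xor_) (xor-identityʳ (Y (suc zero)))

xorAll-sumOne-sorts : ∀ (i : Fin k) W → xorAll (W ∘ sort (sumOne i)) ≡ false
xorAll-sumOne-sorts i W = trans (cong (W i xor_) (xor-identityʳ (W i))) (xor-same (W i))

eqSum-instance : {S : RelSet k} → (∀ a → Extensional (rel S a)) → ∀ {i j} → eqSum i j ∈⟨ S ⟩ →
  {Γ : Fin m → Fin k} (x y u v : Fin m) → Γ x ≡ i → Γ y ≡ i → Γ u ≡ j → Γ v ≡ j →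
  Definable S Γ (λ t → (t x xor t y) ≡ (t u xor t v))
eqSum-instance S-ext eqSum∈ x y u v x∶i y∶i u∶j v∶j =
  definable-rename S-ext eqSum∈ (x ◃ y ◃ u ◃ v ◃ λ ())
  λ { zero → x∶i ; (suc zero) → y∶i ; (suc (suc zero)) → u∶j ; (suc (suc (suc zero))) → v∶j }

eqSum-trans : {S : RelSet k} → (∀ a → Extensional (rel S a)) →
              ∀ {i s j} → eqSum i s ∈⟨ S ⟩ → eqSum s j ∈⟨ S ⟩ → eqSum i j ∈⟨ S ⟩
eqSum-trans S-ext {s = s} is sj =
  definable-⇔ (definable-∃ s (definable-∃ s (definable-×
    (eqSum-instance S-ext is x y c c′ refl refl refl refl)
    (eqSum-instance S-ext sj c c′ u v refl refl refl refl))))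
    λ t → mk⇔ (λ (_ , _ , xy≡cc′ , cc′≡uv) → trans xy≡cc′ cc′≡uv)
              (λ xy≡uv → t zero , t (suc zero) , refl , xy≡uv)
  where
  x y u v c c′ : Fin 6
  x = suc (suc zero) ; y = suc (suc (suc zero))
  u = suc (suc (suc (suc zero))) ; v = suc (suc (suc (suc (suc zero))))
  c = suc zero ; c′ = zero

module PairEquations {k : ℕ} {S : RelSet k} (S-ext : ∀ a → Extensional (rel S a)) {I : Fin k → Set}
  (eqSum∈⟨S⟩ : ∀ {i j} → I i → I j → eqSum i j ∈⟨ S ⟩) {s₀ : Fin k} (s₀∈I : I s₀) where

  -- The fresh w carries the partial sum from the first pair to the rest of the chain.
  definable-pairSum : {Γ : Fin m → Fin k} (xs ys : Fin d → Fin m) →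
    (∀ q → Γ (xs q) ≡ Γ (ys q)) → (∀ q → I (Γ (xs q))) →
    (z z′ : Fin m) → Γ z ≡ Γ z′ → I (Γ z) →
    Definable S Γ (λ t → xorAll (λ q → t (xs q) xor t (ys q)) ≡ t z xor t z′)
  definable-pairSum {d = zero} xs ys _ _ z z′ z∼z′ _ =
    definable-⇔ (definable-atom (inj₂ (inj₂ _)) (z ◃ z′ ◃ λ ())
                   λ { zero → refl ; (suc zero) → sym z∼z′ })
      λ t → ≡⇔false≡xor (t z) (t z′)
    where
    ≡⇔false≡xor : ∀ a c → (a ≡ c) ⇔ (false ≡ a xor c)
    ≡⇔false≡xor false false = mk⇔ (λ _ → refl) (λ _ → refl)
    ≡⇔false≡xor true  true  = mk⇔ (λ _ → refl) (λ _ → refl)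
    ≡⇔false≡xor false true  = mk⇔ (λ ()) (λ ())
    ≡⇔false≡xor true  false = mk⇔ (λ ()) (λ ())
  definable-pairSum {d = suc d} {Γ = Γ} xs ys xs∼ys xs∈I z z′ z∼z′ z∈I =
    definable-⇔ (definable-∃ (Γ z) (definable-× first rest))
      λ t → split (t (xs zero) xor t (ys zero)) _ (t z) (t z′)
    where
    first = eqSum-instance S-ext (eqSum∈⟨S⟩ (xs∈I zero) z∈I) (suc (xs zero)) (suc (ys zero)) zero (suc z′)
      refl (sym (xs∼ys zero)) refl (sym z∼z′)
    rest = definable-pairSum (suc ∘ xs ∘ suc) (suc ∘ ys ∘ suc) (xs∼ys ∘ suc) (xs∈I ∘ suc)
             (suc z) zero refl z∈I
    split : ∀ a r c c′ → (∃[ w ] a ≡ w xor c′ × r ≡ c xor w) ⇔ (a xor r ≡ c xor c′)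
    split a r c c′ = mk⇔
      (λ { (w , refl , refl) → solve 3 (λ w c c′ → (w :+ c′) :+ (c :+ w) := c :+ c′) refl w c c′ })
      λ eq → a xor c′ , solve 2 (λ a c′ → a := (a :+ c′) :+ c′) refl a c′ , (begin
        r                ≡⟨ solve 2 (λ a r → r := a :+ (a :+ r)) refl a r ⟩
        a xor (a xor r)  ≡⟨ cong (a xor_) eq ⟩
        a xor (c xor c′) ≡⟨ solve 3 (λ a c c′ → a :+ (c :+ c′) := c :+ (a :+ c′)) refl a c c′ ⟩
        c xor (a xor c′) ∎)
      where open ≡-Reasoning

  -- Both families are paired with the same W (one variable per sort) and equated to w + w′.
  definable-sums-equal : {Γ : Fin m → Fin k} (xs : Fin d → Fin m) (ys : Fin e → Fin m) →
    (∀ q → I (Γ (xs q))) → (∀ q → I (Γ (ys q))) → SameSortParity (Γ ∘ xs) (Γ ∘ ys) →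
    Definable S Γ (λ t → xorAll (t ∘ xs) ≡ xorAll (t ∘ ys))
  definable-sums-equal {m = m} {Γ = Γ} xs ys xs∈I ys∈I same =
    definable-⇔ (definable-∃ⁿ id (definable-∃ s₀ (definable-∃ s₀
                  (definable-× (paired xs xs∈I) (paired ys ys∈I)))))
      λ t → mk⇔ (sums-equal t) (witness t)
    where
    Γ′ = s₀ ◃ s₀ ◃ (id ⧺ Γ)
    old : Fin m → Fin (suc (suc (k + m)))
    old v = suc (suc (k ↑ʳ v))
    var : Fin k → Fin (suc (suc (k + m)))
    var i = suc (suc (i ↑ˡ m))
    paired : (zs : Fin d → Fin m) → (∀ q → I (Γ (zs q))) →
             Definable S Γ′ (λ V → xorAll (λ q → V (old (zs q)) xor V (var (Γ (zs q))))
                                   ≡ V (suc zero) xor V zero)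
    paired zs zs∈I = definable-pairSum (old ∘ zs) (var ∘ Γ ∘ zs)
      (λ q → trans (⧺-↑ʳ id Γ (zs q)) (sym (⧺-↑ˡ id Γ (Γ (zs q)))))
      (λ q → subst I (sym (⧺-↑ʳ id Γ (zs q))) (zs∈I q)) (suc zero) zero refl s₀∈I
    pairedSum : (Fin k → Bool) → (Fin m → Bool) → (Fin d → Fin m) → Bool
    pairedSum W t zs = xorAll (λ q → (W ⧺ t) (k ↑ʳ zs q) xor (W ⧺ t) (Γ (zs q) ↑ˡ m))
    pairedSum-value : ∀ W t (zs : Fin d → Fin m) →
                      pairedSum W t zs ≡ xorAll (t ∘ zs) xor xorAll (W ∘ Γ ∘ zs)
    pairedSum-value W t zs =
      trans (xorAll-cong (λ q → cong₂ _xor_ (⧺-↑ʳ W t (zs q)) (⧺-↑ˡ W t (Γ (zs q)))))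
            (xorAll-xor (t ∘ zs) (W ∘ Γ ∘ zs))
    sums-equal : ∀ t → (∃[ W ] ∃[ w ] ∃[ w′ ] (pairedSum W t xs ≡ w xor w′) × (pairedSum W t ys ≡ w xor w′)) →
                 xorAll (t ∘ xs) ≡ xorAll (t ∘ ys)
    sums-equal t (W , _ , _ , xs-paired , ys-paired) = xor-cancelʳ (xorAll (W ∘ Γ ∘ xs)) (begin
      xorAll (t ∘ xs) xor xorAll (W ∘ Γ ∘ xs) ≡⟨ sym (pairedSum-value W t xs) ⟩
      pairedSum W t xs                        ≡⟨ trans xs-paired (sym ys-paired) ⟩
      pairedSum W t ys                        ≡⟨ pairedSum-value W t ys ⟩
      xorAll (t ∘ ys) xor xorAll (W ∘ Γ ∘ ys) ≡⟨ cong (xorAll (t ∘ ys) xor_) (sym (same W)) ⟩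
      xorAll (t ∘ ys) xor xorAll (W ∘ Γ ∘ xs) ∎)
      where open ≡-Reasoning
    witness : ∀ t → xorAll (t ∘ xs) ≡ xorAll (t ∘ ys) →
              ∃[ W ] ∃[ w ] ∃[ w′ ] (pairedSum W t xs ≡ w xor w′) × (pairedSum W t ys ≡ w xor w′)
    witness t eq = const false , pairedSum (const false) t xs , false ,
      sym (xor-identityʳ _) ,
      trans (pairedSum-value (const false) t ys)
        (trans (cong₂ _xor_ (sym eq) (sym (same (const false))))
          (trans (sym (pairedSum-value (const false) t xs)) (sym (xor-identityʳ _))))

  definable-sum-from-parityRel : {Γ : Fin m → Fin k} (R : SRel k) {β : Bool} →
    R ∈⟨ S ⟩ → IsParityRel R β → Fin (arity R) → (∀ j → I (sort R j)) →
    (xs : Fin d → Fin m) → (∀ q → I (Γ (xs q))) → SameSortParity (Γ ∘ xs) (sort R) →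
    Definable S Γ (λ t → xorAll (t ∘ xs) ≡ β)
  definable-sum-from-parityRel {m = m} {Γ = Γ} R {β} R∈⟨S⟩ R-parity j₀ R∈I xs xs∈I same =
    definable-⇔ (definable-∃ⁿ (sort R) (definable-×
      (definable-rename S-ext R∈⟨S⟩ (_↑ˡ m) (⧺-↑ˡ (sort R) Γ))
      (definable-sums-equal ((arity R ↑ʳ_) ∘ xs) (_↑ˡ m)
        (λ q → subst I (sym (⧺-↑ʳ (sort R) Γ (xs q))) (xs∈I q))
        (λ j → subst I (sym (⧺-↑ˡ (sort R) Γ j)) (R∈I j))
        λ W → trans (xorAll-cong (λ q → cong W (⧺-↑ʳ (sort R) Γ (xs q))))
                (trans (same W) (sym (xorAll-cong (λ j → cong W (⧺-↑ˡ (sort R) Γ j))))))))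
      λ t → mk⇔
        (λ (Y , Y∈R , eq) → trans (sym (old-sum Y t)) (trans eq (to (R-parity _) Y∈R)))
        λ eq → point , from (R-parity _) (trans (new-sum point t) (xorAll-point j₀ β)) ,
               trans (old-sum point t) (trans eq (sym (trans (new-sum point t) (xorAll-point j₀ β))))
    where
    point = updateAt (const false) j₀ (const β)
    new-sum : ∀ Y t → xorAll ((Y ⧺ t) ∘ (_↑ˡ m)) ≡ xorAll Y
    new-sum Y t = xorAll-cong (⧺-↑ˡ Y t)
    old-sum : ∀ Y t → xorAll ((Y ⧺ t) ∘ (arity R ↑ʳ_) ∘ xs) ≡ xorAll (t ∘ xs)
    old-sum Y t = xorAll-cong (⧺-↑ʳ Y t ∘ xs)

-- Pair equations from ρ

xor-common-offset : ∀ o β x y u v →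
  (∃[ z ] ((o xor z) xor (u xor x) ≡ β) × ((o xor z) xor (v xor y) ≡ β)) ⇔ (x xor y ≡ u xor v)
xor-common-offset o β x y u v = mk⇔
  (λ (z , e₁ , e₂) → sym (xor-transpose {u} {x} {v} {y}
                            (xor-cancelˡ (o xor z) {u xor x} {v xor y} (trans e₁ (sym e₂)))))
  offset-solution
  where
  cancels : ∀ w → (o xor o xor β xor w) xor w ≡ β
  cancels w = solve 3 (λ o β w → (o :+ (o :+ (β :+ w))) :+ w := β) refl o β w
  offset-solution : x xor y ≡ u xor v →
                    ∃[ z ] ((o xor z) xor (u xor x) ≡ β) × ((o xor z) xor (v xor y) ≡ β)
  offset-solution eq = o xor β xor u xor x , cancels (u xor x) ,
    trans (cong ((o xor o xor β xor u xor x) xor_) (sym (xor-transpose {u} {v} {x} {y} (sym eq))))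
          (cancels (u xor x))

module _ {k : ℕ} (l : Fin k → ℕ) (b : Bool) where

  private
    N = length (ρSorts l)
    sorts = lookup (ρSorts l)

  -- ρ(… x@p … u@q … z@r …) ∧ ρ(… y@p … v@q … z@r …), every other position of sort s holding W_s.
  eqSum-positions : ∀ {p q} → 3 ≤ N → p ≢ q → eqSum (sorts p) (sorts q) ∈⟨ singleton (ρ l b) ⟩
  eqSum-positions {p} {q} 3≤n p≢q with r , r≢p , r≢q ← avoid-two 3≤n p q =
    definable-⇔ (definable-∃ⁿ id (definable-∃ (sorts r)
                  (definable-× (holds-at x u refl refl) (holds-at y v refl refl))))
      λ t → mk⇔ (to-eqSum t) (from-eqSum t)
    where
    Γ = sort (eqSum (sorts p) (sorts q))
    Γ′ = sorts r ◃ (id ⧺ Γ)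
    x y u v : Fin 4
    x = zero ; y = suc zero ; u = suc (suc zero) ; v = suc (suc (suc zero))
    base : Fin N → Fin (suc (k + 4))
    base pos = suc (sorts pos ↑ˡ 4)
    old : Fin 4 → Fin (suc (k + 4))
    old a = suc (k ↑ʳ a)
    fill : Fin 4 → Fin 4 → Fin N → Fin (suc (k + 4))
    fill a c = updateAt (updateAt (updateAt base r (const zero)) q (const (old c))) p (const (old a))
    holds-at : ∀ a c → Γ a ≡ sorts p → Γ c ≡ sorts q →
               Definable (singleton (ρ l b)) Γ′ (λ V → xorAll (V ∘ fill a c) ≡ b)
    holds-at a c a∶p c∶q = definable-atom (inj₁ tt) (fill a c)
      (∘-updateAt Γ′ p (∘-updateAt Γ′ q (∘-updateAt Γ′ r (λ pos → ⧺-↑ˡ id Γ (sorts pos)) refl)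
        (trans (⧺-↑ʳ id Γ c) c∶q)) (trans (⧺-↑ʳ id Γ a) a∶p))
    fillSum : (Fin k → Bool) → (Fin 4 → Bool) → Bool → Fin 4 → Fin 4 → Bool
    fillSum W t z a c = xorAll ((z ◃ (W ⧺ t)) ∘ fill a c)
    offset : (Fin k → Bool) → (Fin 4 → Bool) → Bool
    offset W t = xorAll (V ∘ base) xor V (base r) xor V (base q) xor V (base p)
      where V = false ◃ (W ⧺ t)
    fillSum-value : ∀ W t z a c → fillSum W t z a c ≡ (offset W t xor z) xor (t c xor t a)
    fillSum-value W t z a c =
      trans (xorAll-updateAt₃ (z ◃ (W ⧺ t)) base p≢q (≢-sym r≢p) (≢-sym r≢q) (old a) (old c) zero)
        (trans (cong₂ (λ e e′ → offset W t xor (z xor e xor e′)) (⧺-↑ʳ W t c) (⧺-↑ʳ W t a))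
               (sym (xor-assoc (offset W t) z (t c xor t a))))
    to-eqSum : ∀ t → (∃[ W ] ∃[ z ] (fillSum W t z x u ≡ b) × (fillSum W t z y v ≡ b)) →
               t x xor t y ≡ t u xor t v
    to-eqSum t (W , z , e₁ , e₂) = to (xor-common-offset (offset W t) b (t x) (t y) (t u) (t v))
      (z , trans (sym (fillSum-value W t z x u)) e₁ , trans (sym (fillSum-value W t z y v)) e₂)
    from-eqSum : ∀ t → t x xor t y ≡ t u xor t v →
                 ∃[ W ] ∃[ z ] (fillSum W t z x u ≡ b) × (fillSum W t z y v ≡ b)
    from-eqSum t eq =
      let z , e₁ , e₂ = from (xor-common-offset (offset (const false) t) b (t x) (t y) (t u) (t v)) eq
      in const false , z , trans (fillSum-value (const false) t z x u) e₁ ,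
                           trans (fillSum-value (const false) t z y v) e₂

-- The three cases

module _ {k : ℕ} (l : Fin k → ℕ) (b : Bool) (3≤n : 3 ≤ length (ρSorts l)) where

  private
    sorts = lookup (ρSorts l)

  ρ-extensional : ∀ a → Extensional (rel (singleton (ρ l b)) a)
  ρ-extensional _ = sumRel-extensional (ρSorts l) b

  ρ-parity : ∀ {β} → b ≡ β → IsParityRel (ρ l b) β
  ρ-parity b≡β Y = mk⇔ (λ e → trans e b≡β) (λ e → trans e (sym b≡β))

  -- A detour through a third position q, as the positions chosen for i and j may coincide.
  eqSum∈⟨ρ⟩ : ∀ {i j} → i ∈ Iset l → j ∈ Iset l → eqSum i j ∈⟨ singleton (ρ l b) ⟩
  eqSum∈⟨ρ⟩ i∈I j∈I with position l i∈I | position l j∈I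
  ... | p , refl | p′ , refl with avoid-two 3≤n p p′
  ...   | q , q≢p , q≢p′ =
    eqSum-trans ρ-extensional (eqSum-positions l b 3≤n (≢-sym q≢p)) (eqSum-positions l b 3≤n q≢p′)

  pos₀ : Fin (length (ρSorts l))
  pos₀ = fromℕ< (≤-trans (s≤s z≤n) 3≤n)

  s₀∈I : sorts pos₀ ∈ Iset l
  s₀∈I = sort∈Iset l pos₀

  module _ where
    open PairEquations ρ-extensional {I = _∈ Iset l} eqSum∈⟨ρ⟩ s₀∈I

    sumRel-Oset∈⟨ρ⟩ : sumRel (Oset l) b ∈⟨ singleton (ρ l b) ⟩
    sumRel-Oset∈⟨ρ⟩ =
      definable-sum-from-parityRel (ρ l b) (rel∈⟨⟩ tt) (ρ-parity refl) pos₀ (sort∈Iset l)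
        id (Oset⊆Iset l ∘ ∈-lookup) λ W → trans (xorAll-Oset l W) (sym (xorAll-ρSorts l W))

    sumOne∈⟨ρ⟩ : Oset l ≡ [] → b ≡ true → ∀ {i} → i ∈ Iset l → sumOne i ∈⟨ singleton (ρ l b) ⟩
    sumOne∈⟨ρ⟩ O≡[] b≡true {i} i∈I =
      definable-⇔
        (definable-sum-from-parityRel (ρ l b) (rel∈⟨⟩ tt) (ρ-parity b≡true) pos₀ (sort∈Iset l) id (λ _ → i∈I)
           λ W → trans (xorAll-sumOne-sorts i W) (sym (xorAll-ρSorts-even l O≡[] W)))
        λ t → ⇔-sym (sumOne-parity i t)

  ρ≐S1 : Oset l ≡ [] → b ≡ false → singleton (ρ l b) ≐ S1 l
  ρ≐S1 O≡[] b≡false = ≐-intro ρ-extensional S1-extensional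
    (λ _ → definable-⇔ (definable-sums-equal {e = 0} id (λ ()) (sort∈Iset l) (λ ()) (xorAll-ρSorts-even l O≡[]))
                       λ t → ⇔-sym (ρ-parity b≡false t))
    λ ((_ , i∈I) , (_ , j∈I)) → eqSum∈⟨ρ⟩ i∈I j∈I
    where
    S1-extensional : ∀ a → Extensional (rel (S1 l) a)
    S1-extensional ((i , _) , (j , _)) = eqSum-extensional i j
    open PairEquations S1-extensional {I = _∈ Iset l}
      (λ i∈I j∈I → rel∈⟨⟩ {S = S1 l} ((_ , i∈I) , (_ , j∈I))) s₀∈I

  ρ≐S2 : Oset l ≡ [] → b ≡ true → singleton (ρ l b) ≐ S2 l
  ρ≐S2 O≡[] b≡true = ≐-intro ρ-extensional S2-extensional
    (λ _ → definable-⇔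
      (definable-sum-from-parityRel (sumOne (sorts pos₀)) (rel∈⟨⟩ {S = S2 l} (inj₂ (_ , s₀∈I)))
         (sumOne-parity (sorts pos₀)) zero (λ _ → s₀∈I) id (sort∈Iset l)
         λ W → trans (xorAll-ρSorts-even l O≡[] W) (sym (xorAll-sumOne-sorts (sorts pos₀) W)))
      λ t → ⇔-sym (ρ-parity b≡true t))
    λ { (inj₁ ((_ , i∈I) , (_ , j∈I))) → eqSum∈⟨ρ⟩ i∈I j∈I
      ; (inj₂ (_ , i∈I))               → sumOne∈⟨ρ⟩ O≡[] b≡true i∈I }
    where
    S2-extensional : ∀ a → Extensional (rel (S2 l) a)
    S2-extensional (inj₁ ((i , _) , (j , _))) = eqSum-extensional i j
    S2-extensional (inj₂ (i , _))             = sumOne-extensional i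
    open PairEquations S2-extensional {I = _∈ Iset l}
      (λ i∈I j∈I → rel∈⟨⟩ {S = S2 l} (inj₁ ((_ , i∈I) , (_ , j∈I)))) s₀∈I

  ρ≐S3 : Oset l ≢ [] → singleton (ρ l b) ≐ S3 l b
  ρ≐S3 O≢[] = ≐-intro ρ-extensional S3-extensional
    (λ _ → definable-sum-from-parityRel (sumRel (Oset l) b) (rel∈⟨⟩ {S = S3 l b} (inj₁ tt))
             (λ _ → mk⇔ id id) (nonempty-index (Oset l) O≢[]) (Oset⊆Iset l ∘ ∈-lookup) id (sort∈Iset l)
             λ W → trans (xorAll-ρSorts l W) (sym (xorAll-Oset l W)))
    λ { (inj₁ tt)                      → sumRel-Oset∈⟨ρ⟩
      ; (inj₂ ((_ , i∈I) , (_ , j∈I))) → eqSum∈⟨ρ⟩ i∈I j∈I }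
    where
    S3-extensional : ∀ a → Extensional (rel (S3 l b) a)
    S3-extensional (inj₁ tt)                  = sumRel-extensional (Oset l) b
    S3-extensional (inj₂ ((i , _) , (j , _))) = eqSum-extensional i j
    open PairEquations S3-extensional {I = _∈ Iset l}
      (λ i∈I j∈I → rel∈⟨⟩ {S = S3 l b} (inj₂ ((_ , i∈I) , (_ , j∈I)))) s₀∈I

lemma3p6 : (k : ℕ) (l : Fin k → ℕ) (b : Bool) →
    3 ≤ sum (map l (allFin k)) →
    (Oset l ≡ [] → b ≡ false → singleton (ρ l b) ≐ S1 l) ×
    (Oset l ≡ [] → b ≡ true → singleton (ρ l b) ≐ S2 l) ×
    (Oset l ≢ [] → singleton (ρ l b) ≐ S3 l b)
lemma3p6 k l b 3≤Σl = ρ≐S1 l b 3≤n , ρ≐S2 l b 3≤n , ρ≐S3 l b 3≤n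
  where
  3≤n : 3 ≤ length (ρSorts l)
  3≤n = subst (3 ≤_) (sym (length-concatMap-replicate l (allFin k))) 3≤Σl
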